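{- Let $k\ge1$, let $N=\sum_{i=k}^{2k-1}\binom{2k-1}{i}$, and suppose there is an integer $P$ such that every $N$-transitive tournament $T$ satisfies $dom(T)\le P$. Then every $k$-majority tournament $T$ satisfies $dom(T)\le P$; that is, $maj(k)\le p\!\left(\sum_{i=k}^{2k-1}\binom{2k-1}{i}\right)$.
   Context: A $k$-majority tournament is defined on a finite set $V$ by $2k-1$ linear orders $L_1,\dots,L_{2k-1}$ on $V$: the pair $x,y$ is oriented $xy$ iff $x<_{L_i}y$ for a majority of the indices $i$. A tournament is $n$-transitive if its edges can be colored with $n$ colors so that for each color the digraph of edges of that color is transitive. $dom(T)$ is the minimum size of a vertex set $D$ such that every $v\notin D$ has some $w\in D$ with $wv\in E(T)$. $maj(k)$ is the maximum of $dom(T)$ over $k$-majority tournaments and $p(n)$ the maximum of $dom(T)$ over $n$-transitive tournaments. -}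

module Defs where

open import Level using (0ℓ)
open import Data.Nat using (ℕ; suc; _+_; _∸_; _*_; _≤_; _<_)
open import Data.Nat.Combinatorics using (_C_)
open import Data.Fin using (Fin; toℕ)
open import Data.Fin.Subset using (Subset; _∈_; _∉_; ∣_∣)
open import Data.Fin.Permutation using (Permutation′; _⟨$⟩ʳ_)
open import Data.Product using (Σ; ∃; _×_; _,_)
open import Data.Sum using (_⊎_)
open import Relation.Nullary using (¬_)
open import Relation.Binary.PropositionalEquality using (_≡_)

record Tournament (m : ℕ) : Set₁ where
  field
    E       : Fin m → Fin m → Set
    irrefl  : ∀ x → ¬ E x x
    asym    : ∀ x y → E x y → ¬ E y x
    total   : ∀ x y → ¬ x ≡ y → E x y ⊎ E y x
open Tournament public

LinearOrder : ℕ → Set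
LinearOrder m = Permutation′ m

_<[_]_ : ∀ {m} → Fin m → LinearOrder m → Fin m → Set
x <[ L ] y = toℕ (L ⟨$⟩ʳ x) < toℕ (L ⟨$⟩ʳ y)

IsMajority : (k : ℕ) → ∀ {m} → Tournament m → Set
IsMajority k {m} T =
  Σ (Fin (2 * k ∸ 1) → LinearOrder m) λ L →
    ∀ x y → ¬ x ≡ y →
      (E T x y → Σ (Subset (2 * k ∸ 1)) λ S → k ≤ ∣ S ∣ × (∀ i → i ∈ S → x <[ L i ] y))
      × ((Σ (Subset (2 * k ∸ 1)) λ S → k ≤ ∣ S ∣ × (∀ i → i ∈ S → x <[ L i ] y)) → E T x y)

-- n-transitive: the arcs can be coloured with n colours so that each colour class
-- is a transitive digraph.
IsNTransitive : (n : ℕ) → ∀ {m} → Tournament m → Set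
IsNTransitive n {m} T =
  Σ (Fin m → Fin m → Fin n) λ c →
    ∀ x y z → E T x y → E T y z → c x y ≡ c y z → E T x z × c x z ≡ c x y

DomAtMost : ∀ {m} → Tournament m → ℕ → Set
DomAtMost {m} T P =
  Σ (Subset m) λ D → ∣ D ∣ ≤ P × (∀ v → v ∉ D → ∃ λ w → w ∈ D × E T w v)

sumBinom : (n : ℕ) → (i : ℕ) → (len : ℕ) → ℕ
sumBinom n i 0 = 0
sumBinom n i (suc len) = n C i + sumBinom n (suc i) len

majN : ℕ → ℕ
majN k = sumBinom (2 * k ∸ 1) k k

-- Colour an arc xy of a k-majority tournament by its agreement set, the set of indices i with
-- x <_{L_i} y. It has at least k of the 2k-1 elements, so at most N colours occur. If xy and yz
-- have the same agreement set S, then x < y < z in every L_i with i ∈ S and z < y < x in every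
-- other L_i, so xz has agreement set S too: it is an arc of colour S.
module Submission where

open import Defs
open import Level using (Level)
open import Data.Nat using (ℕ; zero; suc; pred; _+_; _*_; _∸_; _≤_; _<_; z≤n; s≤s; _≤?_; _<?_)
open import Data.Nat.Properties
  using (+-mono-≤; ≤-trans; ≤-refl; <-trans; <⇒≱; ≮⇒≥; m<n⇒m<1+n; m≤n+m; pred-mono-≤;
         +-identityʳ)
open import Data.Nat.Combinatorics using (_C_; nCk+nC[k+1]≡[n+1]C[k+1])
open import Data.Nat.Tactic.RingSolver using (solve-∀)
open import Data.Vec using ([]; _∷_; here; there)
open import Data.Fin using (Fin; zero; suc; toℕ; _↑ˡ_; _↑ʳ_; splitAt; inject≤)
open import Data.Fin.Properties using (splitAt-↑ˡ; splitAt-↑ʳ; inject≤-injective)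
open import Data.Fin.Subset using (Subset; inside; outside; _∈_; _⊆_; ∣_∣; ⊤)
open import Data.Fin.Subset.Properties using (⊆-antisym; p⊆q⇒∣p∣≤∣q∣; ∣⊤∣≡n)
open import Data.Fin.Permutation using (_⟨$⟩ʳ_)
open import Data.Product using (_×_; _,_; proj₁; proj₂)
open import Data.Sum using (inj₁; inj₂)
open import Data.Empty using (⊥-elim)
open import Relation.Nullary using (¬_; does; yes; no)
open import Relation.Nullary.Decidable using (dec-true)
open import Relation.Unary using (Pred; Decidable)
open import Relation.Binary.PropositionalEquality
  using (_≡_; refl; sym; cong; subst; module ≡-Reasoning)

private
  variable
    n : ℕ
    ℓ : Level

subsets≥ : ℕ → ℕ → ℕ
subsets≥ zero    zero    = 1
subsets≥ zero    (suc _) = 0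
subsets≥ (suc n) i       = subsets≥ n i + subsets≥ n (pred i)

encode : ∀ i (p : Subset n) → i ≤ ∣ p ∣ → Fin (subsets≥ n i)
encode {suc n} i (outside ∷ p) h = encode i p h ↑ˡ subsets≥ n (pred i)
encode {suc n} i (inside  ∷ p) h = subsets≥ n i ↑ʳ encode (pred i) p (pred-mono-≤ h)
encode zero    []            _ = zero
encode (suc i) []            ()

decode : ∀ n i → Fin (subsets≥ n i) → Subset n
decode zero    i _ = []
decode (suc n) i f with splitAt (subsets≥ n i) f
... | inj₁ f′ = outside ∷ decode n i f′
... | inj₂ f′ = inside  ∷ decode n (pred i) f′

decode-encode : ∀ i (p : Subset n) (h : i ≤ ∣ p ∣) → decode n i (encode i p h) ≡ p
decode-encode {suc n} i (outside ∷ p) h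
  rewrite splitAt-↑ˡ (subsets≥ n i) (encode i p h) (subsets≥ n (pred i))
  = cong (outside ∷_) (decode-encode i p h)
decode-encode {suc n} i (inside ∷ p) h
  rewrite splitAt-↑ʳ (subsets≥ n i) (subsets≥ n (pred i)) (encode (pred i) p (pred-mono-≤ h))
  = cong (inside ∷_) (decode-encode (pred i) p (pred-mono-≤ h))
decode-encode zero    []            _ = refl
decode-encode (suc i) []            ()

encode-injective : ∀ i {p q : Subset n} (hp : i ≤ ∣ p ∣) (hq : i ≤ ∣ q ∣) →
                   encode i p hp ≡ encode i q hq → p ≡ q
encode-injective {n} i {p} {q} hp hq eq = begin
  p                           ≡⟨ sym (decode-encode i p hp) ⟩
  decode n i (encode i p hp)  ≡⟨ cong (decode n i) eq ⟩
  decode n i (encode i q hq)  ≡⟨ decode-encode i q hq ⟩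
  q                           ∎
  where open ≡-Reasoning

-- Subsets with fewer than i elements get an arbitrary code; only large ones are ever compared.
module _ {i} (i≤n : i ≤ n) where

  code : Subset n → Fin (subsets≥ n i)
  code p with i ≤? ∣ p ∣
  ... | yes h = encode i p h
  ... | no  _ = encode i (⊤ {n}) (subst (i ≤_) (sym (∣⊤∣≡n n)) i≤n)

  code-injective : ∀ {p q} → i ≤ ∣ p ∣ → i ≤ ∣ q ∣ → code p ≡ code q → p ≡ q
  code-injective {p} {q} hp hq eq with i ≤? ∣ p ∣ | i ≤? ∣ q ∣
  ... | yes hp′ | yes hq′ = encode-injective i hp′ hq′ eq
  ... | no ¬hp  | _       = ⊥-elim (¬hp hp)
  ... | yes _   | no ¬hq  = ⊥-elim (¬hq hq)

sumBinom-suc : ∀ n i L → sumBinom (suc n) (suc i) L ≡ sumBinom n (suc i) L + sumBinom n i L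
sumBinom-suc n i zero = refl
sumBinom-suc n i (suc L)
  rewrite sym (nCk+nC[k+1]≡[n+1]C[k+1] n i) | sumBinom-suc n (suc i) L
  = interchange (n C i) (n C suc i) (sumBinom n (suc (suc i)) L) (sumBinom n (suc i) L)
  where
  interchange : ∀ a b c d → (a + b) + (c + d) ≡ (b + c) + (a + d)
  interchange = solve-∀

subsets≥≤sumBinom : ∀ n i L → n < i + L → subsets≥ n i ≤ sumBinom n i L
subsets≥≤sumBinom zero    zero    (suc L) _ = s≤s z≤n
subsets≥≤sumBinom zero    (suc i) L       _ = z≤n
subsets≥≤sumBinom (suc n) zero    (suc L) (s≤s n<L)
  rewrite sumBinom-suc n 0 L
  = +-mono-≤ (subsets≥≤sumBinom n 0 (suc L) (m<n⇒m<1+n n<L)) (subsets≥≤sumBinom n 0 L n<L)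
subsets≥≤sumBinom (suc n) (suc i) L       (s≤s n<i+L)
  rewrite sumBinom-suc n i L
  = +-mono-≤ (subsets≥≤sumBinom n (suc i) L (m<n⇒m<1+n n<i+L)) (subsets≥≤sumBinom n i L n<i+L)

satisfying : {P : Pred (Fin n) ℓ} → Decidable P → Subset n
satisfying {zero}  P? = []
satisfying {suc n} P? = does (P? zero) ∷ satisfying (λ i → P? (suc i))

∈-satisfying⁺ : ∀ {P : Pred (Fin n) ℓ} (P? : Decidable P) {i} → P i → i ∈ satisfying P?
∈-satisfying⁺ P? {zero}  Pi rewrite dec-true (P? zero) Pi = here
∈-satisfying⁺ P? {suc i} Pi = there (∈-satisfying⁺ (λ j → P? (suc j)) Pi)

∈-satisfying⁻ : ∀ {P : Pred (Fin n) ℓ} (P? : Decidable P) {i} → i ∈ satisfying P? → P i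
∈-satisfying⁻ P? {zero}  i∈ with P? zero | i∈
... | yes Pi | _ = Pi
∈-satisfying⁻ P? {suc i} (there i∈) = ∈-satisfying⁻ (λ j → P? (suc j)) i∈

module _ {m r} (L : Fin r → LinearOrder m) where

  precedes? : ∀ x y → Decidable (λ i → x <[ L i ] y)
  precedes? x y i = toℕ (L i ⟨$⟩ʳ x) <? toℕ (L i ⟨$⟩ʳ y)

  agreement : Fin m → Fin m → Subset r
  agreement x y = satisfying (precedes? x y)

  agreement-trans : ∀ {x y z} → agreement x y ≡ agreement y z → agreement x z ≡ agreement x y
  agreement-trans {x} {y} {z} same = ⊆-antisym xz⊆xy xy⊆xz
    where
    xy⊆xz : agreement x y ⊆ agreement x z
    xy⊆xz {i} i∈xy = ∈-satisfying⁺ (precedes? x z) (<-trans x<y y<z)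
      where
      x<y = ∈-satisfying⁻ (precedes? x y) i∈xy
      y<z = ∈-satisfying⁻ (precedes? y z) (subst (i ∈_) same i∈xy)

    xz⊆xy : agreement x z ⊆ agreement x y
    xz⊆xy {i} i∈xz with precedes? x y i
    ... | yes x<y = ∈-satisfying⁺ (precedes? x y) x<y
    ... | no  x≮y = ⊥-elim (<⇒≱ x<z (≤-trans (≮⇒≥ y≮z) (≮⇒≥ x≮y)))
      where
      x<z = ∈-satisfying⁻ (precedes? x z) i∈xz
      y≮z : ¬ y <[ L i ] z
      y≮z y<z = x≮y (∈-satisfying⁻ (precedes? x y)
                       (subst (i ∈_) (sym same) (∈-satisfying⁺ (precedes? y z) y<z)))

k≤2k∸1 : ∀ k → 1 ≤ k → k ≤ 2 * k ∸ 1
k≤2k∸1 (suc k) _ rewrite +-identityʳ k = m≤n+m (suc k) k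

2k∸1<k+k : ∀ k → 1 ≤ k → 2 * k ∸ 1 < k + k
2k∸1<k+k (suc k) _ rewrite +-identityʳ k = ≤-refl

majority⇒nTransitive : ∀ {k m} (T : Tournament m) → 1 ≤ k →
                       IsMajority k T → IsNTransitive (majN k) T
majority⇒nTransitive {k} {m} T 1≤k (L , majority) = colour , colour-transitive
  where
  colourOf : Subset (2 * k ∸ 1) → Fin (majN k)
  colourOf S = inject≤ (code (k≤2k∸1 k 1≤k) S)
                       (subsets≥≤sumBinom (2 * k ∸ 1) k k (2k∸1<k+k k 1≤k))

  colour : Fin m → Fin m → Fin (majN k)
  colour x y = colourOf (agreement L x y)

  arc⇒≢ : ∀ {x y} → E T x y → ¬ x ≡ y
  arc⇒≢ {x} exy refl = irrefl T x exy

  arc⇒large : ∀ {x y} → E T x y → k ≤ ∣ agreement L x y ∣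
  arc⇒large {x} {y} exy with proj₁ (majority x y (arc⇒≢ exy)) exy
  ... | S , k≤∣S∣ , S-precedes = ≤-trans k≤∣S∣ (p⊆q⇒∣p∣≤∣q∣ S⊆agreement)
    where
    S⊆agreement : S ⊆ agreement L x y
    S⊆agreement {i} i∈S = ∈-satisfying⁺ (precedes? L x y) (S-precedes i i∈S)

  large⇒arc : ∀ {x y} → ¬ x ≡ y → k ≤ ∣ agreement L x y ∣ → E T x y
  large⇒arc {x} {y} x≢y large =
    proj₂ (majority x y x≢y) (agreement L x y , large , λ i → ∈-satisfying⁻ (precedes? L x y))

  colour-transitive : ∀ x y z → E T x y → E T y z → colour x y ≡ colour y z →
                      E T x z × colour x z ≡ colour x y
  colour-transitive x y z exy eyz same =
    large⇒arc x≢z (subst (λ S → k ≤ ∣ S ∣) (sym xz≡xy) (arc⇒large exy)) , cong colourOf xz≡xy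
    where
    xy≡yz : agreement L x y ≡ agreement L y z
    xy≡yz = code-injective _ (arc⇒large exy) (arc⇒large eyz) (inject≤-injective _ _ _ _ same)

    xz≡xy : agreement L x z ≡ agreement L x y
    xz≡xy = agreement-trans L xy≡yz

    x≢z : ¬ x ≡ z
    x≢z refl = asym T x y exy eyz

proposition1p13 : (k : ℕ) → 1 ≤ k → (P : ℕ) →
    (∀ (m : ℕ) (T : Tournament m) → IsNTransitive (majN k) T → DomAtMost T P) →
    ∀ (m : ℕ) (T : Tournament m) → IsMajority k T → DomAtMost T P
proposition1p13 k 1≤k P nTransitive⇒dom m T majority =
  nTransitive⇒dom m T (majority⇒nTransitive T 1≤k majority)
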